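{- For each $k\in\mathbb N\cup\{\infty\}$ with $k\ge1$, $\Pi_k$ is a functor from $\mathcal G$ to $\mathcal P$. That is, for every morphism $f:G\to H$ of hypergraphs, the same function $f:V(G)\to V(H)$ is a morphism $\Pi_k(G)\to\Pi_k(H)$ in $\mathcal P$.
   Context: A hypergraph is a triple $G=(V,E,\epsilon)$, where $V$ is a finite vertex set, $E$ is a finite edge set disjoint from $V$, and $\epsilon:E\to 2^V$ assigns to each edge its vertex set. Distinct edges may have the same vertex set. A morphism $H\to G$ is an injective map $f:V(H)\to V(G)$ such that for every edge $e$ of $H$ there is an edge $e'$ of $G$ with $f_*(\epsilon_H(e))=\epsilon_G(e')$, where $f_*(A)=f(A)$. This gives the category $\mathcal G$. $\mathcal P$ is the category whose objects are pairs $(V,P)$ with $V$ a finite set and $P\subseteq 2^V$ a set of "parts". Parts need not be disjoint or cover $V$, and $P$ may be empty. A morphism $(V,P)\to(W,Q)$ in $\mathcal P$ is a function $f:V\to W$ such that for every $p\in P$ there is $q\in Q$ with $f_*(p)\subseteq q$. For $k\in\mathbb N\cup\{\infty\}$, the $k$-line graph $\Lambda_k(G)$ is the simple graph with vertex set $\{\epsilon(e):e\in E\}$, in which distinct $u,v$ are adjacent iff $|u\cap v|\ge k$ (no edges if $k=\infty$). $\Pi_k(G)$ is the object of $\mathcal P$ with underlying set $V(G)$ whose parts are the sets $\bigcup_{x\in C}x$, where $C$ ranges over the vertex sets of the connected components of $\Lambda_k(G)$, including singleton components. -}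

module Defs where

open import Data.Nat using (ℕ; _≤_)
open import Data.Fin using (Fin)
open import Data.Fin.Subset using (Subset; _∈_; _∩_; ∣_∣)
open import Data.Product using (Σ; ∃; _×_)
open import Data.Empty using (⊥)
open import Data.Unit using (⊤)
open import Relation.Nullary using (¬_)
open import Relation.Binary.PropositionalEquality using (_≡_)
open import Relation.Binary.Construct.Closure.ReflexiveTransitive using (Star)
open import Function.Definitions using (Injective)
open import Function.Bundles using (_⇔_)

data ℕ∞ : Set where
  fin : ℕ → ℕ∞
  ∞   : ℕ∞

_≤∞_ : ℕ∞ → ℕ → Set
fin k ≤∞ n = k ≤ n
∞     ≤∞ n = ⊥

OneLe : ℕ∞ → Set
OneLe (fin k) = 1 ≤ k
OneLe ∞       = ⊤

-- A hypergraph with vertex set Fin nV, edge set Fin nE, and ε assigning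
-- to each edge its vertex set (a subset of Fin nV).  Distinct edges may have
-- the same vertex set.
record Hypergraph : Set where
  field
    nV : ℕ
    nE : ℕ
    ε  : Fin nE → Subset nV
open Hypergraph public

ImageIs : ∀ {n m} → (Fin n → Fin m) → Subset n → Subset m → Set
ImageIs f A B = ∀ y → (y ∈ B) ⇔ (∃ λ x → x ∈ A × f x ≡ y)

record HMorphism (G H : Hypergraph) : Set where
  field
    fun       : Fin (nV G) → Fin (nV H)
    injective : Injective _≡_ _≡_ fun
    edges     : ∀ (e : Fin (nE G)) → ∃ λ (e' : Fin (nE H)) → ImageIs fun (ε G e) (ε H e')
open HMorphism public

record PObj : Set₁ where
  field
    size  : ℕ
    Parts : Subset size → Set
open PObj public

IsPMorphism : (A B : PObj) → (Fin (size A) → Fin (size B)) → Set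
IsPMorphism A B f =
  ∀ (p : Subset (size A)) → Parts A p →
    ∃ λ (q : Subset (size B)) → Parts B q × (∀ x → x ∈ p → f x ∈ q)

ΛVertex : (G : Hypergraph) → Subset (nV G) → Set
ΛVertex G u = ∃ λ e → ε G e ≡ u

ΛAdj : ℕ∞ → (G : Hypergraph) → Subset (nV G) → Subset (nV G) → Set
ΛAdj k G u v = ΛVertex G u × ΛVertex G v × ¬ (u ≡ v) × (k ≤∞ ∣ u ∩ v ∣)

ΛConn : ℕ∞ → (G : Hypergraph) → Subset (nV G) → Subset (nV G) → Set
ΛConn k G = Star (ΛAdj k G)

InComponentUnion : ℕ∞ → (G : Hypergraph) → Subset (nV G) → Fin (nV G) → Set
InComponentUnion k G u x = ∃ λ v → ΛVertex G v × ΛConn k G u v × x ∈ v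

Π : ℕ∞ → Hypergraph → PObj
Π k G = record
  { size  = nV G
  ; Parts = λ p → ∃ λ u → ΛVertex G u × (∀ x → (x ∈ p) ⇔ InComponentUnion k G u x)
  }

{-# OPTIONS --safe #-}

-- An injective morphism sends every edge onto an edge, and injectivity preserves both the
-- distinctness of edge sets and the sizes of their intersections. Hence adjacent vertices
-- of Λ_k(G) go to adjacent vertices of Λ_k(H), each component of Λ_k(G) lands in a
-- component of Λ_k(H), and the union of the former maps into the union of the latter.
-- Constructively that union must be produced as a Subset, i.e. membership in it must be
-- decided; this reduces to reachability in a finite decidable graph, which is decided by
-- growing a forward-closed set of reachable nodes.
module Submission where

open import Defs

open import Level using (Level; 0ℓ)
open import Data.Bool.Properties using (T-≡) renaming (_≟_ to _≟ᵇ_)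
open import Data.Nat using (ℕ; _≤_; _≤?_; z≤n)
open import Data.Nat.Properties using (≤-trans; ≤-<-trans)
open import Data.Fin using (Fin; zero; suc)
open import Data.Fin.Properties using (any?; 0≢1+n; suc-injective)
open import Data.Fin.Subset using (Subset; _∈_; _∉_; _⊂_; _⊃_; _∩_; _∪_; _-_; ∣_∣; ⁅_⁆; inside; outside)
open import Data.Fin.Subset.Properties using (_∈?_; x∈p∪q⁺; x∈p∪q⁻; x∈⁅x⁆; x∈⁅y⁆⇒x≡y; x∈p∩q⁺; x∈p∩q⁻; x∈p⇒∣p-x∣<∣p∣; x∈p∧x≢y⇒x∈p-y; ⊆-antisym)
open import Data.Fin.Subset.Induction using (Acc; acc; ⊃-wellFounded)
open import Data.Vec using (_∷_; []; tabulate)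
open import Data.Vec.Properties using (≡-dec; lookup∘tabulate; []=⇒lookup; lookup⇒[]=)
open import Data.Vec.Base using (here; there)
open import Data.Product using (∃; ∃₂; _×_; _,_)
open import Data.Sum using (_⊎_; inj₁; inj₂)
open import Function using (_∘_)
open import Function.Definitions using (Injective)
open import Function.Bundles using (_⇔_; mk⇔; Equivalence)
open import Relation.Nullary using (Dec; yes; no; ¬?)
open import Relation.Nullary.Decidable using (_×-dec_; decidable-stable; isYes; toWitness; fromWitness)
open import Relation.Unary using (Pred) renaming (Decidable to Decidable₁)
open import Relation.Binary using (Rel; Decidable)
open import Relation.Binary.PropositionalEquality using (_≡_; _≢_; refl; sym; trans; subst)
open import Relation.Binary.Construct.Closure.ReflexiveTransitive as Star using (Star; _◅_; _◅◅_; gmap)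

private
  variable
    ℓ : Level
    m n : ℕ

comprehension : {P : Pred (Fin n) ℓ} → Decidable₁ P → Subset n
comprehension P? = tabulate (isYes ∘ P?)

∈-comprehension : {P : Pred (Fin n) ℓ} (P? : Decidable₁ P) (x : Fin n) →
                  x ∈ comprehension P? ⇔ P x
∈-comprehension P? x = mk⇔
  (λ x∈ → toWitness {a? = P? x}
            (Equivalence.from T-≡ (trans (sym (lookup∘tabulate _ x)) ([]=⇒lookup x∈))))
  (λ Px → lookup⇒[]= x _ (trans (lookup∘tabulate _ x) (Equivalence.to T-≡ (fromWitness Px))))

injection⇒∣p∣≤∣q∣ : (f : Fin m → Fin n) → Injective _≡_ _≡_ f → (p : Subset m) (q : Subset n) →
                    (∀ {x} → x ∈ p → f x ∈ q) → ∣ p ∣ ≤ ∣ q ∣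
injection⇒∣p∣≤∣q∣ f f-inj []            q p↦q = z≤n
injection⇒∣p∣≤∣q∣ f f-inj (outside ∷ p) q p↦q =
  injection⇒∣p∣≤∣q∣ (f ∘ suc) (λ eq → suc-injective (f-inj eq)) p q (p↦q ∘ there)
injection⇒∣p∣≤∣q∣ f f-inj (inside ∷ p)  q p↦q =
  ≤-<-trans (injection⇒∣p∣≤∣q∣ (f ∘ suc) (λ eq → suc-injective (f-inj eq)) p (q - f zero) p↦q-f0)
            (x∈p⇒∣p-x∣<∣p∣ (p↦q here))
  where
  p↦q-f0 : ∀ {x} → x ∈ p → f (suc x) ∈ q - f zero
  p↦q-f0 x∈p = x∈p∧x≢y⇒x∈p-y (p↦q (there x∈p)) (λ eq → 0≢1+n (sym (f-inj eq)))

ForwardClosed : Rel (Fin n) ℓ → Subset n → Set ℓ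
ForwardClosed R B = ∀ {x y} → x ∈ B → R x y → y ∈ B

ForwardClosed-Star : ∀ {R : Rel (Fin n) ℓ} {B x y} → ForwardClosed R B → x ∈ B → Star R x y → y ∈ B
ForwardClosed-Star closed x∈B Star.ε      = x∈B
ForwardClosed-Star closed x∈B (xRz ◅ z↝y) = ForwardClosed-Star closed (closed x∈B xRz) z↝y

module _ {R : Rel (Fin n) ℓ} (R? : Decidable R) where

  closed-or-exit : (A : Subset n) → ForwardClosed R A ⊎ ∃₂ λ x y → x ∈ A × y ∉ A × R x y
  closed-or-exit A with any? (λ x → any? λ y → x ∈? A ×-dec ¬? (y ∈? A) ×-dec R? x y)
  ... | yes (x , y , exit) = inj₂ (x , y , exit)
  ... | no ¬exit           = inj₁ λ {x} {y} x∈A xRy →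
    decidable-stable (y ∈? A) λ y∉A → ¬exit (x , y , x∈A , y∉A , xRy)

  ForwardClosure : Fin n → Subset n → Set ℓ
  ForwardClosure i B = i ∈ B × (∀ {y} → y ∈ B → Star R i y) × ForwardClosed R B

  extendToForwardClosure : ∀ {i} (A : Subset n) → Acc _⊃_ A → i ∈ A → (∀ {y} → y ∈ A → Star R i y) →
                           ∃ (ForwardClosure i)
  extendToForwardClosure A (acc larger) i∈A A↝ with closed-or-exit A
  ... | inj₁ closed = A , i∈A , A↝ , closed
  ... | inj₂ (x , y , x∈A , y∉A , xRy) =
    extendToForwardClosure (A ∪ ⁅ y ⁆) (larger A⊂A∪y) (x∈p∪q⁺ (inj₁ i∈A)) A∪y↝
    where
    A⊂A∪y : A ⊂ A ∪ ⁅ y ⁆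
    A⊂A∪y = x∈p∪q⁺ ∘ inj₁ , y , x∈p∪q⁺ (inj₂ (x∈⁅x⁆ y)) , y∉A
    A∪y↝ : ∀ {z} → z ∈ A ∪ ⁅ y ⁆ → Star R _ z
    A∪y↝ z∈ with x∈p∪q⁻ A ⁅ y ⁆ z∈
    ... | inj₁ z∈A = A↝ z∈A
    ... | inj₂ z∈⁅y⁆ rewrite x∈⁅y⁆⇒x≡y y z∈⁅y⁆ = A↝ x∈A ◅◅ (xRy ◅ Star.ε)

  forwardClosure : (i : Fin n) → ∃ (ForwardClosure i)
  forwardClosure i = extendToForwardClosure ⁅ i ⁆ (⊃-wellFounded _) (x∈⁅x⁆ i) λ y∈⁅i⁆ →
    subst (Star R i) (sym (x∈⁅y⁆⇒x≡y i y∈⁅i⁆)) Star.ε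

  Star? : Decidable (Star R)
  Star? i j with forwardClosure i
  ... | B , i∈B , B↝ , closed with j ∈? B
  ...   | yes j∈B = yes (B↝ j∈B)
  ...   | no  j∉B = no (j∉B ∘ ForwardClosed-Star closed i∈B)

≤∞-≤-trans : ∀ k {a b} → k ≤∞ a → a ≤ b → k ≤∞ b
≤∞-≤-trans (fin k) = ≤-trans
≤∞-≤-trans ∞       ()

_≤∞?_ : ∀ k n → Dec (k ≤∞ n)
fin k ≤∞? n = k ≤? n
∞     ≤∞? n = no λ ()

module _ {G H : Hypergraph} (f : HMorphism G H) where

  image-⊆ : ∀ {a a'} → ImageIs (fun f) a a' → ∀ {x} → x ∈ a → fun f x ∈ a'
  image-⊆ a↦a' {x} x∈a = Equivalence.from (a↦a' (fun f x)) (x , x∈a , refl)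

  image-reflects : ∀ {a a'} → ImageIs (fun f) a a' → ∀ {x} → fun f x ∈ a' → x ∈ a
  image-reflects a↦a' {x} fx∈a' with Equivalence.to (a↦a' (fun f x)) fx∈a'
  ... | z , z∈a , fz≡fx = subst (_∈ _) (injective f fz≡fx) z∈a

  image-injective : ∀ {a a' b b'} → ImageIs (fun f) a a' → ImageIs (fun f) b b' → a' ≡ b' → a ≡ b
  image-injective a↦a' b↦b' refl =
    ⊆-antisym (image-reflects b↦b' ∘ image-⊆ a↦a') (image-reflects a↦a' ∘ image-⊆ b↦b')

  ∣∩∣-image : ∀ {a a' b b'} → ImageIs (fun f) a a' → ImageIs (fun f) b b' → ∣ a ∩ b ∣ ≤ ∣ a' ∩ b' ∣
  ∣∩∣-image {a} {a'} {b} {b'} a↦a' b↦b' =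
    injection⇒∣p∣≤∣q∣ (fun f) (injective f) (a ∩ b) (a' ∩ b') λ x∈a∩b →
      let x∈a , x∈b = x∈p∩q⁻ a b x∈a∩b in x∈p∩q⁺ (image-⊆ a↦a' x∈a , image-⊆ b↦b' x∈b)

  ΛVertex-image : ∀ {a} → ΛVertex G a → ∃ λ a' → ΛVertex H a' × ImageIs (fun f) a a'
  ΛVertex-image (e , refl) = let e' , e↦e' = edges f e in ε H e' , (e' , refl) , e↦e'

  ΛAdj-image : ∀ {k a a' b b'} → ΛAdj k G a b → ΛVertex H a' → ΛVertex H b' →
               ImageIs (fun f) a a' → ImageIs (fun f) b b' → ΛAdj k H a' b'
  ΛAdj-image {k} (_ , _ , a≢b , k≤∣a∩b∣) Λa' Λb' a↦a' b↦b' =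
    Λa' , Λb' , a≢b ∘ image-injective a↦a' b↦b' , ≤∞-≤-trans k k≤∣a∩b∣ (∣∩∣-image a↦a' b↦b')

  ΛConn-image : ∀ {k u u' v} → ΛVertex H u' → ImageIs (fun f) u u' → ΛConn k G u v →
                ∃ λ v' → ΛVertex H v' × ImageIs (fun f) v v' × ΛConn k H u' v'
  ΛConn-image Λu' u↦u' Star.ε = _ , Λu' , u↦u' , Star.ε
  ΛConn-image Λu' u↦u' (u~w@(_ , Λw , _) ◅ w~v) =
    let w' , Λw' , w↦w' = ΛVertex-image Λw
        v' , Λv' , v↦v' , w'~v' = ΛConn-image Λw' w↦w' w~v
    in v' , Λv' , v↦v' , ΛAdj-image u~w Λu' Λw' u↦u' w↦w' ◅ w'~v'

  InComponentUnion-image : ∀ {k u u' x} → ΛVertex H u' → ImageIs (fun f) u u' →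
                           InComponentUnion k G u x → InComponentUnion k H u' (fun f x)
  InComponentUnion-image Λu' u↦u' (v , _ , u~v , x∈v) =
    let v' , Λv' , v↦v' , u'~v' = ΛConn-image Λu' u↦u' u~v in v' , Λv' , u'~v' , image-⊆ v↦v' x∈v

-- Vertices of Λ_k(H) are subsets, not elements of a finite index type, so connectivity
-- is decided on edge indices instead.
module _ (k : ℕ∞) (H : Hypergraph) where

  EdgeAdj : Rel (Fin (nE H)) 0ℓ
  EdgeAdj i j = ε H i ≢ ε H j × k ≤∞ ∣ ε H i ∩ ε H j ∣

  EdgeAdj? : Decidable EdgeAdj
  EdgeAdj? i j = ¬? (≡-dec _≟ᵇ_ (ε H i) (ε H j)) ×-dec k ≤∞? ∣ ε H i ∩ ε H j ∣

  ΛConn⇒EdgeConn : ∀ {i v} → ΛConn k H (ε H i) v → ∃ λ j → ε H j ≡ v × Star EdgeAdj i j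
  ΛConn⇒EdgeConn {i} Star.ε = i , refl , Star.ε
  ΛConn⇒EdgeConn ((_ , (l , refl) , i~l) ◅ l~v) =
    let j , j≡v , l~j = ΛConn⇒EdgeConn l~v in j , j≡v , i~l ◅ l~j

  EdgeConn⇒ΛConn : ∀ {i j} → Star EdgeAdj i j → ΛConn k H (ε H i) (ε H j)
  EdgeConn⇒ΛConn = gmap (ε H) λ i~j → (_ , refl) , (_ , refl) , i~j

  InComponentUnion? : ∀ i → Decidable₁ (InComponentUnion k H (ε H i))
  InComponentUnion? i x with any? (λ j → Star? EdgeAdj? i j ×-dec x ∈? ε H j)
  ... | yes (j , i~j , x∈j) = yes (ε H j , (j , refl) , EdgeConn⇒ΛConn i~j , x∈j)
  ... | no ∄j = no λ (v , _ , i~v , x∈v) →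
    let j , j≡v , i~j = ΛConn⇒EdgeConn i~v in ∄j (j , i~j , subst (x ∈_) (sym j≡v) x∈v)

  componentUnion : Fin (nE H) → Subset (nV H)
  componentUnion i = comprehension (InComponentUnion? i)

  componentUnion-part : ∀ i → Parts (Π k H) (componentUnion i)
  componentUnion-part i = ε H i , (i , refl) , ∈-comprehension (InComponentUnion? i)

mainTheorem3 : (k : ℕ∞) → OneLe k → (G H : Hypergraph) (f : HMorphism G H) →
    IsPMorphism (Π k G) (Π k H) (fun f)
mainTheorem3 k _ G H f p (u , Λu , p⇔) with ΛVertex-image f Λu
... | _ , (i , refl) , u↦i =
  componentUnion k H i , componentUnion-part k H i , λ x x∈p →
    Equivalence.from (∈-comprehension (InComponentUnion? k H i) (fun f x))
      (InComponentUnion-image f (i , refl) u↦i (Equivalence.to (p⇔ x) x∈p))
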